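{- Let $s,k,n$ be natural numbers with $n\ge k$ and $n\ge s$, and let $Z_{n,k}$ be the $n$-multiset consisting of the $k$ complex $k$-th roots of unity $e^{2\pi i m/k}$ ($m=0,\dots,k-1$) together with $n-k$ zeros. Then $\mathcal M_{s,k,n}=\mathfrak p_k(Z_{n,k}^{(s)})/k$.
   Context: For a multiset $A=\{a_1,\dots,a_n\}$ of complex numbers, $\mathfrak p_j(A)=\sum_i a_i^j$, and for $s\le n$, $A^{(s)}$ denotes the multiset of all $\binom ns$ sums $a_{i_1}+\dots+a_{i_s}$ with $1\le i_1<\dots<i_s\le n$ (with multiplicity). For $s,k\le n$, $\mathcal Q_{s,k,n}(t_1,\dots,t_k)$ is the unique rational polynomial with $\mathfrak p_k(A^{(s)})=\mathcal Q_{s,k,n}(\mathfrak p_1(A),\dots,\mathfrak p_k(A))$ for every $n$-multiset $A$ of complex numbers, and $\mathcal M_{s,k,n}$ is the coefficient of $t_k$ in $\mathcal Q_{s,k,n}$. -}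

module Defs where

open import Level using (Level; _⊔_) renaming (suc to lsuc)
open import Algebra.Bundles using (CommutativeRing)
open import Data.Nat using (ℕ; zero; suc; _<_; _∸_; NonZero)
open import Data.Fin using (Fin; fromℕ; toℕ)
open import Data.Vec using (Vec; replicate; _[_]≔_)
open import Data.Vec.Properties using (≡-dec)
open import Data.List using (List; []; _∷_; map; _++_; upTo; foldr; [_])
import Data.List as L
open import Data.Product using (_×_; _,_; Σ)
open import Data.Rational using (ℚ; 0ℚ; 1ℚ)
import Data.Rational as ℚ
import Data.Nat as ℕ
open import Relation.Nullary using (¬_; yes; no)

-- A field of characteristic 0, given as a commutative ring with inverses
-- of nonzero elements, 1 ≠ 0, and a unital ring homomorphism ι : ℚ → F.
-- (ℂ is the intended instance.)
record CharZeroField (c ℓ : Level) : Set (lsuc (c ⊔ ℓ)) where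
  field
    commRing : CommutativeRing c ℓ
  open CommutativeRing commRing public
  field
    nontrivial : ¬ (1# ≈ 0#)
    inverse    : ∀ x → ¬ (x ≈ 0#) → Σ Carrier λ y → x * y ≈ 1#
    ι          : ℚ → Carrier
    ι-+        : ∀ p q → ι (p ℚ.+ q) ≈ ι p + ι q
    ι-*        : ∀ p q → ι (p ℚ.* q) ≈ ι p * ι q
    ι-1        : ι 1ℚ ≈ 1#

-- Polynomials in k variables t₁,…,t_k with rational coefficients, given as a
-- finite list of terms (coefficient, exponent vector); variable t_{j+1} has index j.
Poly : ℕ → Set
Poly k = List (ℚ × Vec ℕ k)

coeffVar : ∀ {k} → Poly k → Fin k → ℚ
coeffVar {k} [] i = 0ℚ
coeffVar {k} ((c , e) ∷ Q) i with ≡-dec ℕ._≟_ e (replicate k 0 [ i ]≔ 1)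
... | yes _ = c ℚ.+ coeffVar Q i
... | no  _ = coeffVar Q i

lastIdx : (k : ℕ) → .{{NonZero k}} → Fin k
lastIdx (suc k) = fromℕ k

module FieldOps {c ℓ} (F : CharZeroField c ℓ) where
  open CharZeroField F

  pow : Carrier → ℕ → Carrier
  pow x zero    = 1#
  pow x (suc j) = x * pow x j

  sumL : List Carrier → Carrier
  sumL = foldr _+_ 0#

  𝔭 : ℕ → List Carrier → Carrier
  𝔭 j xs = sumL (map (λ x → pow x j) xs)

  -- A^(s): all sums a_{i₁}+…+a_{i_s} with i₁<…<i_s, with multiplicity
  sSums : ℕ → List Carrier → List Carrier
  sSums zero    xs       = [ 0# ]
  sSums (suc s) []       = []
  sSums (suc s) (x ∷ xs) = map (x +_) (sSums s xs) ++ sSums (suc s) xs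

  prodFin : ∀ {k} → (Fin k → Carrier) → Carrier
  prodFin {zero}  f = 1#
  prodFin {suc k} f = f Fin.zero * prodFin (λ i → f (Fin.suc i))

  evalPoly : ∀ {k} → Poly k → (Fin k → Carrier) → Carrier
  evalPoly [] t = 0#
  evalPoly ((q , e) ∷ Q) t =
    ι q * prodFin (λ i → pow (t i) (Data.Vec.lookup e i)) + evalPoly Q t

  IsPrimitiveRoot : ℕ → Carrier → Set ℓ
  IsPrimitiveRoot k ζ = pow ζ k ≈ 1# × (∀ j → 0 < j → j < k → ¬ (pow ζ j ≈ 1#))

  Z : ℕ → ℕ → Carrier → List Carrier
  Z n k ζ = map (pow ζ) (upTo k) ++ L.replicate (n ∸ k) 0#

module Submission where

-- Let k = k'+1 and let A = l·Z_{n,k} for a scalar l.  Since the nonzero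
-- elements of Z_{n,k} are the k-th roots of unity, 𝔭ⱼ(A) = lʲ·𝔭ⱼ(Z_{n,k}) vanishes for
-- 0 < j < k while 𝔭ₖ(A) = lᵏ·k; and 𝔭ₖ(A^(s)) = lᵏ·P with P = 𝔭ₖ(Z_{n,k}^(s)), because
-- scaling commutes with forming s-sums.  So with u = lᵏ·k the hypothesis reads
--   Q(0,…,0,u) = (P/k)·u.
-- The restriction of Q to the axis (0,…,0,u) is a univariate polynomial whose linear
-- coefficient is the coefficient of t_k in Q.  Taking l = 1,2,3,… gives infinitely many
-- distinct points u (characteristic zero), and a polynomial vanishing at infinitely many
-- points is zero, so that coefficient is P/k.

open import Defs
open import Data.Nat using (ℕ; zero; suc; _≤_; _<_; s≤s; z≤n; NonZero)
import Data.Nat as ℕ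
import Data.Nat.Properties as ℕ
open import Data.Fin using (Fin; toℕ; fromℕ)
import Data.Fin as Fin
open import Data.Vec using (Vec; toList; fromList; lookup; replicate; _[_]≔_)
import Data.Vec as Vec
open import Data.Vec.Properties using (toList∘fromList; ≡-dec)
open import Data.List using (List; []; _∷_; _++_; map; length; applyUpTo; upTo)
import Data.List as List
import Data.List.Properties as List
open import Data.List.Relation.Unary.All using (All; []; _∷_)
open import Data.Integer using (+_)
import Data.Integer as ℤ
import Data.Integer.Properties as ℤ
open import Data.Rational using (ℚ; mkℚ; _/_; 0ℚ; 1ℚ)
import Data.Rational as ℚ
import Data.Rational.Properties as ℚ
import Data.Rational.Unnormalised.Properties as ℚᵘ
open import Data.Rational.Unnormalised using (*≡*)
open import Data.Nat.Coprimality using (1-coprimeTo)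
import Data.Nat.Coprimality as Coprime
open import Data.Product using (_×_; _,_; proj₁)
open import Data.Sum using (_⊎_; inj₁; inj₂)
open import Data.Empty using (⊥-elim)
open import Function using (_∘_)
open import Function.Definitions using (Injective)
open import Relation.Nullary using (¬_; yes; no)
open import Relation.Binary.Definitions using (tri<; tri≈; tri>)
open import Relation.Binary.PropositionalEquality as ≡ using (_≡_; _≢_)

ℕ→ℚ : ℕ → ℚ
ℕ→ℚ m = mkℚ (+ m) 0 (Coprime.sym (1-coprimeTo m))

ℕ→ℚ-suc : ∀ m → ℕ→ℚ (suc m) ≡ 1ℚ ℚ.+ ℕ→ℚ m
ℕ→ℚ-suc m = ℚ.toℚᵘ-injective
  (ℚᵘ.≃-trans (*≡* numerators) (ℚᵘ.≃-sym (ℚ.toℚᵘ-homo-+ 1ℚ (ℕ→ℚ m))))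
  where
  numerators : + suc m ℤ.* + 1 ≡ (+ 1 ℤ.+ + m ℤ.* + 1) ℤ.* + 1
  numerators = ≡.trans (ℤ.*-identityʳ _)
    (≡.sym (≡.trans (ℤ.*-identityʳ _) (≡.cong (ℤ._+_ (+ 1)) (ℤ.*-identityʳ (+ m)))))

-- 1/k, written (+ 1) / k as in the statement, is the inverse of k.
1/k*k≡1 : ∀ m → (+ 1 / suc m) ℚ.* ℕ→ℚ (suc m) ≡ 1ℚ
1/k*k≡1 m = ≡.trans (≡.cong (ℚ._* ℕ→ℚ (suc m)) (ℚ.normalize-coprime (1-coprimeTo (suc m))))
                    (ℚ.*-inverseˡ (ℕ→ℚ (suc m)))

^-injectiveˡ : ∀ k .{{_ : NonZero k}} → Injective _≡_ _≡_ (ℕ._^ k)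
^-injectiveˡ k {a} {b} aᵏ≡bᵏ with ℕ.<-cmp a b
... | tri< a<b _ _ = ⊥-elim (ℕ.<-irrefl aᵏ≡bᵏ (ℕ.^-monoˡ-< k a<b))
... | tri≈ _ a≡b _ = a≡b
... | tri> _ _ b<a = ⊥-elim (ℕ.<-irrefl (≡.sym aᵏ≡bᵏ) (ℕ.^-monoˡ-< k b<a))

fromVecs : ∀ {a p} {A : Set a} {n} (P : List A → Set p) →
           (∀ (v : Vec A n) → P (toList v)) → ∀ xs → length xs ≡ n → P xs
fromVecs P P-vec xs ≡.refl = ≡.subst P (toList∘fromList xs) (P-vec (fromList xs))

module InField {c ℓ} (F : CharZeroField c ℓ) where
  open CharZeroField F
  open FieldOps F
  open import Relation.Binary.Reasoning.Setoid setoid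
  open import Data.List.Relation.Binary.Equality.Setoid setoid using (_≋_; []; _∷_; ≋-trans; ≋-reflexive; ++⁺; map⁺)
  open import Algebra.Properties.Ring ring
    using (+-cancelˡ; +-cancelʳ; +-inverseʳ-unique; -‿involutive; +-identityˡ-unique; x∙y⁻¹≈ε⇒x≈y; x≈y⇒x∙y⁻¹≈ε; [y-z]x≈yx-zx; -‿distribˡ-*)
  open import Algebra.Properties.Semiring.Exp semiring using (_^_; ^-assocʳ)
  open import Algebra.Properties.CommutativeSemiring.Exp commutativeSemiring using (^-distrib-*)
  open import Algebra.Properties.Semiring.Mult semiring using (×1-homo-*) renaming (_×_ to _·_)
  open import Algebra.Solver.Ring.NaturalCoefficients.Default commutativeSemiring

  pow≈^ : ∀ x n → pow x n ≈ x ^ n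
  pow≈^ x zero    = refl
  pow≈^ x (suc n) = *-congˡ (pow≈^ x n)

  pow-cong : ∀ {x y} n → x ≈ y → pow x n ≈ pow y n
  pow-cong zero    x≈y = refl
  pow-cong (suc n) x≈y = *-cong x≈y (pow-cong n x≈y)

  pow-distrib-* : ∀ x y n → pow (x * y) n ≈ pow x n * pow y n
  pow-distrib-* x y n = begin
    pow (x * y) n     ≈⟨ pow≈^ (x * y) n ⟩
    (x * y) ^ n       ≈⟨ ^-distrib-* x y n ⟩
    x ^ n * y ^ n     ≈⟨ *-cong (pow≈^ x n) (pow≈^ y n) ⟨
    pow x n * pow y n ∎

  pow-swap : ∀ x a b → pow (pow x a) b ≈ pow (pow x b) a
  pow-swap x a b = begin
    pow (pow x a) b ≈⟨ pow-cong b (pow≈^ x a) ⟩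
    pow (x ^ a) b   ≈⟨ pow≈^ (x ^ a) b ⟩
    (x ^ a) ^ b     ≈⟨ ^-assocʳ x a b ⟩
    x ^ (a ℕ.* b)   ≡⟨ ≡.cong (x ^_) (ℕ.*-comm a b) ⟩
    x ^ (b ℕ.* a)   ≈⟨ ^-assocʳ x b a ⟨
    (x ^ b) ^ a     ≈⟨ pow≈^ (x ^ b) a ⟨
    pow (x ^ b) a   ≈⟨ pow-cong a (pow≈^ x b) ⟨
    pow (pow x b) a ∎

  pow-one : ∀ {x} n → x ≈ 1# → pow x n ≈ 1#
  pow-one zero    x≈1 = refl
  pow-one (suc n) x≈1 = trans (*-cong x≈1 (pow-one n x≈1)) (*-identityˡ 1#)

  [_] : ℕ → Carrier
  [ m ] = m · 1#

  [^] : ∀ m j → [ m ℕ.^ j ] ≈ pow [ m ] j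
  [^] m zero    = +-identityʳ 1#
  [^] m (suc j) = trans (×1-homo-* m (m ℕ.^ j)) (*-congˡ ([^] m j))

  ι-0 : ι 0ℚ ≈ 0#
  ι-0 = +-identityˡ-unique (ι 0ℚ) (ι 0ℚ) (sym (ι-+ 0ℚ 0ℚ))

  ι-ℕ : ∀ m → [ m ] ≈ ι (ℕ→ℚ m)
  ι-ℕ zero    = sym ι-0
  ι-ℕ (suc m) = begin
    1# + [ m ]             ≈⟨ +-cong (sym ι-1) (ι-ℕ m) ⟩
    ι 1ℚ + ι (ℕ→ℚ m)       ≈⟨ ι-+ 1ℚ (ℕ→ℚ m) ⟨
    ι (1ℚ ℚ.+ ℕ→ℚ m)       ≡⟨ ≡.cong ι (ℕ→ℚ-suc m) ⟨
    ι (ℕ→ℚ (suc m))        ∎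

  ι[1/k]*k≈1 : ∀ m → ι (+ 1 / suc m) * [ suc m ] ≈ 1#
  ι[1/k]*k≈1 m = begin
    ι (+ 1 / suc m) * [ suc m ]             ≈⟨ *-congˡ (ι-ℕ (suc m)) ⟩
    ι (+ 1 / suc m) * ι (ℕ→ℚ (suc m))       ≈⟨ ι-* (+ 1 / suc m) (ℕ→ℚ (suc m)) ⟨
    ι ((+ 1 / suc m) ℚ.* ℕ→ℚ (suc m))       ≡⟨ ≡.cong ι (1/k*k≡1 m) ⟩
    ι 1ℚ                                    ≈⟨ ι-1 ⟩
    1#                                      ∎

  -- characteristic zero: a positive integer is nonzero in F, since it is invertible
  [suc]≉0 : ∀ m → ¬ ([ suc m ] ≈ 0#)
  [suc]≉0 m m+1≈0 = nontrivial (begin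
    1#                          ≈⟨ ι[1/k]*k≈1 m ⟨
    ι (+ 1 / suc m) * [ suc m ] ≈⟨ *-congˡ m+1≈0 ⟩
    ι (+ 1 / suc m) * 0#        ≈⟨ zeroʳ _ ⟩
    0#                          ∎)

  []-injective : Injective _≡_ _≈_ [_]
  []-injective {zero}  {zero}  _   = ≡.refl
  []-injective {zero}  {suc b} 0≈b = ⊥-elim ([suc]≉0 b (sym 0≈b))
  []-injective {suc a} {zero}  a≈0 = ⊥-elim ([suc]≉0 a a≈0)
  []-injective {suc a} {suc b} a≈b = ≡.cong suc ([]-injective (+-cancelˡ 1# [ a ] [ b ] a≈b))

  no-zero-divisors : ∀ {x y} → ¬ (x ≈ 0#) → x * y ≈ 0# → y ≈ 0#
  no-zero-divisors {x} {y} x≉0 xy≈0 with inverse x x≉0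
  ... | x⁻¹ , xx⁻¹≈1 = begin
    y              ≈⟨ *-identityˡ y ⟨
    1# * y         ≈⟨ *-congʳ (trans (sym xx⁻¹≈1) (*-comm x x⁻¹)) ⟩
    (x⁻¹ * x) * y  ≈⟨ *-assoc x⁻¹ x y ⟩
    x⁻¹ * (x * y)  ≈⟨ *-congˡ xy≈0 ⟩
    x⁻¹ * 0#       ≈⟨ zeroʳ x⁻¹ ⟩
    0#             ∎

  distinct-factors⇒zero : ∀ {x y z} → ¬ (x ≈ y) → x * z ≈ y * z → z ≈ 0#
  distinct-factors⇒zero {x} {y} {z} x≉y xz≈yz =
    no-zero-divisors (x≉y ∘ x∙y⁻¹≈ε⇒x≈y x y)
                     (trans ([y-z]x≈yx-zx z x y) (x≈y⇒x∙y⁻¹≈ε xz≈yz))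

  sumL-++ : ∀ xs ys → sumL (xs ++ ys) ≈ sumL xs + sumL ys
  sumL-++ []       ys = sym (+-identityˡ (sumL ys))
  sumL-++ (x ∷ xs) ys = trans (+-congˡ (sumL-++ xs ys)) (sym (+-assoc x (sumL xs) (sumL ys)))

  𝔭-++ : ∀ j xs ys → 𝔭 j (xs ++ ys) ≈ 𝔭 j xs + 𝔭 j ys
  𝔭-++ j xs ys = trans (reflexive (≡.cong sumL (List.map-++ (λ x → pow x j) xs ys)))
                       (sumL-++ (map (λ x → pow x j) xs) (map (λ x → pow x j) ys))

  𝔭-cong : ∀ j {xs ys} → xs ≋ ys → 𝔭 j xs ≈ 𝔭 j ys
  𝔭-cong j []             = refl
  𝔭-cong j (x≈y ∷ xs≋ys) = +-cong (pow-cong j x≈y) (𝔭-cong j xs≋ys)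

  𝔭-scale : ∀ l j xs → 𝔭 j (map (l *_) xs) ≈ pow l j * 𝔭 j xs
  𝔭-scale l j []       = sym (zeroʳ (pow l j))
  𝔭-scale l j (x ∷ xs) = begin
    pow (l * x) j + 𝔭 j (map (l *_) xs)  ≈⟨ +-cong (pow-distrib-* l x j) (𝔭-scale l j xs) ⟩
    pow l j * pow x j + pow l j * 𝔭 j xs ≈⟨ distribˡ (pow l j) (pow x j) (𝔭 j xs) ⟨
    pow l j * (pow x j + 𝔭 j xs)         ∎

  𝔭-zeros : ∀ j r → 𝔭 (suc j) (List.replicate r 0#) ≈ 0#
  𝔭-zeros j zero    = refl
  𝔭-zeros j (suc r) = trans (+-cong (zeroˡ _) (𝔭-zeros j r)) (+-identityʳ 0#)

  module _ (h : Carrier → Carrier) (h-0 : h 0# ≈ 0#)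
           (h-+ : ∀ x y → h (x + y) ≈ h x + h y) where

    private
      shift : ∀ x ys → map (_+_ (h x)) (map h ys) ≋ map h (map (_+_ x) ys)
      shift x []       = []
      shift x (y ∷ ys) = sym (h-+ x y) ∷ shift x ys

    sSums-map : ∀ s xs → sSums s (map h xs) ≋ map h (sSums s xs)
    sSums-map zero    xs       = sym h-0 ∷ []
    sSums-map (suc s) []       = []
    sSums-map (suc s) (x ∷ xs) = ≋-trans
      (++⁺ (≋-trans (map⁺ setoid +-congˡ (sSums-map s xs)) (shift x (sSums s xs)))
           (sSums-map (suc s) xs))
      (≋-reflexive (≡.sym (List.map-++ h (map (_+_ x) (sSums s xs)) (sSums (suc s) xs))))

  𝔭-sSums-scale : ∀ l j s xs → 𝔭 j (sSums s (map (l *_) xs)) ≈ pow l j * 𝔭 j (sSums s xs)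
  𝔭-sSums-scale l j s xs =
    trans (𝔭-cong j (sSums-map (l *_) (zeroʳ l) (distribˡ l) s xs)) (𝔭-scale l j (sSums s xs))

  sumUpTo : (ℕ → Carrier) → ℕ → Carrier
  sumUpTo g N = sumL (applyUpTo g N)

  sumUpTo-cong : ∀ N {g h} → (∀ m → g m ≈ h m) → sumUpTo g N ≈ sumUpTo h N
  sumUpTo-cong zero    g≈h = refl
  sumUpTo-cong (suc N) g≈h = +-cong (g≈h 0) (sumUpTo-cong N (g≈h ∘ suc))

  sumUpTo-* : ∀ y N g → sumUpTo (λ m → y * g m) N ≈ y * sumUpTo g N
  sumUpTo-* y zero    g = sym (zeroʳ y)
  sumUpTo-* y (suc N) g =
    trans (+-congˡ (sumUpTo-* y N (g ∘ suc))) (sym (distribˡ y (g 0) (sumUpTo (g ∘ suc) N)))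

  sumUpTo-last : ∀ g N → sumUpTo g (suc N) ≈ sumUpTo g N + g N
  sumUpTo-last g N = begin
    sumL (applyUpTo g (suc N))               ≡⟨ ≡.cong sumL (List.applyUpTo-∷ʳ g N) ⟨
    sumL (applyUpTo g N ++ List.[ g N ])     ≈⟨ sumL-++ (applyUpTo g N) List.[ g N ] ⟩
    sumUpTo g N + (g N + 0#)                 ≈⟨ +-congˡ (+-identityʳ (g N)) ⟩
    sumUpTo g N + g N                        ∎

  sumUpTo-ones : ∀ N {g} → (∀ m → g m ≈ 1#) → sumUpTo g N ≈ [ N ]
  sumUpTo-ones zero    g≈1 = refl
  sumUpTo-ones (suc N) g≈1 = +-cong (g≈1 0) (sumUpTo-ones N (g≈1 ∘ suc))

  geometric : ∀ y N → y * sumUpTo (pow y) N + 1# ≈ sumUpTo (pow y) N + pow y N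
  geometric y N = begin
    y * sumUpTo (pow y) N + 1#  ≈⟨ +-comm _ 1# ⟩
    1# + y * sumUpTo (pow y) N  ≈⟨ +-congˡ (sumUpTo-* y N (pow y)) ⟨
    sumUpTo (pow y) (suc N)     ≈⟨ sumUpTo-last (pow y) N ⟩
    sumUpTo (pow y) N + pow y N ∎

  geometric-vanishes : ∀ y N → pow y N ≈ 1# → ¬ (y ≈ 1#) → sumUpTo (pow y) N ≈ 0#
  geometric-vanishes y N yᴺ≈1 y≉1 = distinct-factors⇒zero y≉1 (begin
    y * G   ≈⟨ +-cancelʳ 1# (y * G) G (trans (geometric y N) (+-congˡ yᴺ≈1)) ⟩
    G       ≈⟨ *-identityˡ G ⟨
    1# * G  ∎)
    where G = sumUpTo (pow y) N

  𝔭-Z : ∀ n k ζ j → 𝔭 (suc j) (Z n k ζ) ≈ sumUpTo (pow (pow ζ (suc j))) k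
  𝔭-Z n k ζ j = begin
    𝔭 (suc j) (roots ++ zeros)                  ≈⟨ 𝔭-++ (suc j) roots zeros ⟩
    𝔭 (suc j) roots + 𝔭 (suc j) zeros           ≈⟨ +-cong 𝔭-roots (𝔭-zeros j (n ℕ.∸ k)) ⟩
    sumUpTo (pow (pow ζ (suc j))) k + 0#        ≈⟨ +-identityʳ _ ⟩
    sumUpTo (pow (pow ζ (suc j))) k             ∎
    where
    roots = map (pow ζ) (upTo k)
    zeros = List.replicate (n ℕ.∸ k) 0#
    𝔭-roots : 𝔭 (suc j) roots ≈ sumUpTo (pow (pow ζ (suc j))) k
    𝔭-roots = begin
      𝔭 (suc j) roots                                 ≡⟨ ≡.cong (sumL ∘ map (λ x → pow x (suc j)))
                                                           (List.map-applyUpTo (λ m → m) (pow ζ) k) ⟩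
      𝔭 (suc j) (applyUpTo (pow ζ) k)                 ≡⟨ ≡.cong sumL
                                                           (List.map-applyUpTo (pow ζ) (λ x → pow x (suc j)) k) ⟩
      sumUpTo (λ m → pow (pow ζ m) (suc j)) k         ≈⟨ sumUpTo-cong k (λ m → pow-swap ζ m (suc j)) ⟩
      sumUpTo (pow (pow ζ (suc j))) k                 ∎

  -- for 0 < j < k, ζʲ ≠ 1 is a k-th root of unity, so 𝔭ⱼ(Z_{n,k}) = 0
  𝔭-Z-below : ∀ n k ζ j → IsPrimitiveRoot k ζ → 0 < j → j < k → 𝔭 j (Z n k ζ) ≈ 0#
  𝔭-Z-below n k ζ (suc j) (ζᵏ≈1 , ζ-primitive) 0<j j<k = trans (𝔭-Z n k ζ j)
    (geometric-vanishes (pow ζ (suc j)) k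
      (trans (pow-swap ζ (suc j) k) (pow-one (suc j) ζᵏ≈1))
      (ζ-primitive (suc j) 0<j j<k))

  𝔭-Z-top : ∀ n k' ζ → pow ζ (suc k') ≈ 1# → 𝔭 (suc k') (Z n (suc k') ζ) ≈ [ suc k' ]
  𝔭-Z-top n k' ζ ζᵏ≈1 = trans (𝔭-Z n (suc k') ζ k') (sumUpTo-ones (suc k') (λ m → pow-one m ζᵏ≈1))

  -- Univariate polynomials, as coefficient lists a₀ ∷ a₁ ∷ ⋯ (lowest degree first).

  IsZero : Carrier → Set ℓ
  IsZero a = a ≈ 0#

  ev : List Carrier → Carrier → Carrier
  ev []       u = 0#
  ev (a ∷ as) u = a + u * ev as u

  ev-zero : ∀ {as} → All IsZero as → ∀ u → ev as u ≈ 0#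
  ev-zero []              u = refl
  ev-zero (a≈0 ∷ as≈0) u = trans (+-cong a≈0 (trans (*-congˡ (ev-zero as≈0 u)) (zeroʳ u))) (+-identityʳ 0#)

  ev-constant : ∀ a {as} → All IsZero as → ∀ u → ev (a ∷ as) u ≈ a
  ev-constant a as≈0 u = trans (+-congˡ (trans (*-congˡ (ev-zero as≈0 u)) (zeroʳ u))) (+-identityʳ a)

  -- Synthetic division: for P = a₀ + u·(a₁ + a₂u + ⋯) with as = a₁ ∷ a₂ ∷ ⋯, the
  -- quotient of P by (u − p) has as its coefficients the tails aᵢ₊₁ + aᵢ₊₂u + ⋯ at p.
  quotient : List Carrier → Carrier → List Carrier
  quotient []       p = []
  quotient (b ∷ bs) p = ev (b ∷ bs) p ∷ quotient bs p

  length-quotient : ∀ as p → length (quotient as p) ≡ length as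
  length-quotient []       p = ≡.refl
  length-quotient (b ∷ bs) p = ≡.cong suc (length-quotient bs p)

  -- The factor theorem P(u) − P(p) = (u − p)·Q(u), in subtraction-free form.
  factor : ∀ a as u p → ev (a ∷ as) u + p * ev (quotient as p) u
                        ≈ ev (a ∷ as) p + u * ev (quotient as p) u
  factor a []       u p = solve 4 (λ a u p z → a :+ u :* z :+ p :* z := a :+ p :* z :+ u :* z)
                                  refl a u p 0#
  factor a (b ∷ bs) u p = begin
    (a + u * Pᵤ) + p * (Pₚ + u * Qᵤ) ≈⟨ solve 6 (λ a u p Pᵤ Pₚ Qᵤ →
                                          (a :+ u :* Pᵤ) :+ p :* (Pₚ :+ u :* Qᵤ)
                                       := (a :+ p :* Pₚ) :+ u :* (Pᵤ :+ p :* Qᵤ)) refl a u p Pᵤ Pₚ Qᵤ ⟩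
    (a + p * Pₚ) + u * (Pᵤ + p * Qᵤ) ≈⟨ +-congˡ (*-congˡ (factor b bs u p)) ⟩
    (a + p * Pₚ) + u * (Pₚ + u * Qᵤ) ∎
    where
    Pᵤ = ev (b ∷ bs) u
    Pₚ = ev (b ∷ bs) p
    Qᵤ = ev (quotient bs p) u

  quotient-zero : ∀ as p → All IsZero (quotient as p) → All IsZero as
  quotient-zero []       p []          = []
  quotient-zero (b ∷ bs) p (Pₚ≈0 ∷ Q≈0) = trans (sym (ev-constant b bs≈0 p)) Pₚ≈0 ∷ bs≈0
    where bs≈0 = quotient-zero bs p Q≈0

  -- A polynomial vanishing at infinitely many distinct points f 0, f 1, … is zero:
  -- divide by (u − f 0) and recurse on the quotient with the points f 1, f 2, ….
  vanishing⇒zero : ∀ n as → length as ≡ n → (f : ℕ → Carrier) → Injective _≡_ _≈_ f →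
                   (∀ j → ev as (f j) ≈ 0#) → All IsZero as
  vanishing⇒zero _       []       _   f f-inj roots = []
  vanishing⇒zero (suc n) (a ∷ as) len f f-inj roots = a≈0 ∷ as≈0
    where
    p = f 0
    Q = quotient as p
    Q-roots : ∀ j → ev Q (f (suc j)) ≈ 0#
    Q-roots j = distinct-factors⇒zero (λ u≈p → ℕ.1+n≢0 (f-inj u≈p)) (begin
      u * ev Q u                          ≈⟨ +-identityˡ _ ⟨
      0# + u * ev Q u                     ≈⟨ +-congʳ (roots 0) ⟨
      ev (a ∷ as) p + u * ev Q u          ≈⟨ factor a as u p ⟨
      ev (a ∷ as) u + p * ev Q u          ≈⟨ +-congʳ (roots (suc j)) ⟩
      0# + p * ev Q u                     ≈⟨ +-identityˡ _ ⟩
      p * ev Q u                          ∎)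
      where u = f (suc j)
    as≈0 : All IsZero as
    as≈0 = quotient-zero as p (vanishing⇒zero n Q
      (≡.trans (length-quotient as p) (ℕ.suc-injective len))
      (f ∘ suc) (ℕ.suc-injective ∘ f-inj) Q-roots)
    a≈0 : a ≈ 0#
    a≈0 = trans (sym (ev-constant a as≈0 p)) (roots 0)

  -- Sparse univariate polynomials: lists of monomials (c , m) standing for c·uᵐ.

  Monomials : Set c
  Monomials = List (Carrier × ℕ)

  evM : Monomials → Carrier → Carrier
  evM []            u = 0#
  evM ((c , m) ∷ S) u = c * pow u m + evM S u

  monoCoef : ℕ → ℕ → Carrier → Carrier
  monoCoef zero    zero    a = a
  monoCoef zero    (suc m) a = 0#
  monoCoef (suc j) zero    a = 0#
  monoCoef (suc j) (suc m) a = monoCoef j m a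

  monoCoef-zero : ∀ j m {a} → a ≈ 0# → monoCoef j m a ≈ 0#
  monoCoef-zero zero    zero    a≈0 = a≈0
  monoCoef-zero zero    (suc m) a≈0 = refl
  monoCoef-zero (suc j) zero    a≈0 = refl
  monoCoef-zero (suc j) (suc m) a≈0 = monoCoef-zero j m a≈0

  monoCoef-≢ : ∀ m {a} → m ≢ 1 → monoCoef 1 m a ≈ 0#
  monoCoef-≢ zero          m≢1 = refl
  monoCoef-≢ (suc zero)    m≢1 = ⊥-elim (m≢1 ≡.refl)
  monoCoef-≢ (suc (suc m)) m≢1 = refl

  coefM : ℕ → Monomials → Carrier
  coefM j []            = 0#
  coefM j ((a , m) ∷ S) = monoCoef j m a + coefM j S

  coef : List Carrier → ℕ → Carrier
  coef []       j       = 0#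
  coef (a ∷ as) zero    = a
  coef (a ∷ as) (suc j) = coef as j

  coef-zero : ∀ {as} → All IsZero as → ∀ j → coef as j ≈ 0#
  coef-zero []           j       = refl
  coef-zero (a≈0 ∷ as≈0) zero    = a≈0
  coef-zero (a≈0 ∷ as≈0) (suc j) = coef-zero as≈0 j

  addMono : Carrier → ℕ → List Carrier → List Carrier
  addMono a zero    []        = a ∷ []
  addMono a zero    (b ∷ bs)  = (a + b) ∷ bs
  addMono a (suc m) []        = 0# ∷ addMono a m []
  addMono a (suc m) (b ∷ bs)  = b ∷ addMono a m bs

  ev-addMono : ∀ a m bs u → ev (addMono a m bs) u ≈ a * pow u m + ev bs u
  ev-addMono a zero    []       u = trans (+-congˡ (zeroʳ u)) (+-congʳ (sym (*-identityʳ a)))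
  ev-addMono a zero    (b ∷ bs) u = trans (+-assoc a b _) (+-congʳ (sym (*-identityʳ a)))
  ev-addMono a (suc m) []       u = begin
    0# + u * ev (addMono a m []) u ≈⟨ +-identityˡ _ ⟩
    u * ev (addMono a m []) u      ≈⟨ *-congˡ (trans (ev-addMono a m [] u) (+-identityʳ _)) ⟩
    u * (a * pow u m)              ≈⟨ solve 3 (λ u a p → u :* (a :* p) := a :* (u :* p) :+ con 0)
                                            refl u a (pow u m) ⟩
    a * (u * pow u m) + 0#         ∎
  ev-addMono a (suc m) (b ∷ bs) u = begin
    b + u * ev (addMono a m bs) u  ≈⟨ +-congˡ (*-congˡ (ev-addMono a m bs u)) ⟩
    b + u * (a * pow u m + ev bs u) ≈⟨ solve 5 (λ b u a p E → b :+ u :* (a :* p :+ E)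
                                                := a :* (u :* p) :+ (b :+ u :* E))
                                             refl b u a (pow u m) (ev bs u) ⟩
    a * (u * pow u m) + (b + u * ev bs u) ∎

  coef-addMono : ∀ a m bs j → coef (addMono a m bs) j ≈ monoCoef j m a + coef bs j
  coef-addMono a zero    []       zero    = sym (+-identityʳ a)
  coef-addMono a zero    []       (suc j) = sym (+-identityʳ 0#)
  coef-addMono a zero    (b ∷ bs) zero    = refl
  coef-addMono a zero    (b ∷ bs) (suc j) = sym (+-identityˡ _)
  coef-addMono a (suc m) []       zero    = sym (+-identityʳ 0#)
  coef-addMono a (suc m) []       (suc j) = coef-addMono a m [] j
  coef-addMono a (suc m) (b ∷ bs) zero    = sym (+-identityˡ b)
  coef-addMono a (suc m) (b ∷ bs) (suc j) = coef-addMono a m bs j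

  toDense : Monomials → List Carrier
  toDense []            = []
  toDense ((a , m) ∷ S) = addMono a m (toDense S)

  ev-toDense : ∀ S u → ev (toDense S) u ≈ evM S u
  ev-toDense []            u = refl
  ev-toDense ((a , m) ∷ S) u = trans (ev-addMono a m (toDense S) u) (+-congˡ (ev-toDense S u))

  coef-toDense : ∀ S j → coef (toDense S) j ≈ coefM j S
  coef-toDense []            j = refl
  coef-toDense ((a , m) ∷ S) j = trans (coef-addMono a m (toDense S) j) (+-congˡ (coef-toDense S j))

  monomials-vanishing⇒zero : ∀ S (f : ℕ → Carrier) → Injective _≡_ _≈_ f →
                             (∀ j → evM S (f j) ≈ 0#) → ∀ j → coefM j S ≈ 0#
  monomials-vanishing⇒zero S f f-inj roots j = trans (sym (coef-toDense S j))
    (coef-zero (vanishing⇒zero _ (toDense S) ≡.refl f f-inj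
                  (λ i → trans (ev-toDense S (f i)) (roots i))) j)

  linear-on-points⇒coef : ∀ S c (f : ℕ → Carrier) → Injective _≡_ _≈_ f →
                          (∀ j → evM S (f j) ≈ c * f j) → coefM 1 S ≈ c
  linear-on-points⇒coef S c f f-inj agree = begin
    coefM 1 S        ≈⟨ +-inverseʳ-unique (- c) (coefM 1 S) difference-coef≈0 ⟩
    - (- c)          ≈⟨ -‿involutive c ⟩
    c                ∎
    where
    difference-roots : ∀ j → evM ((- c , 1) ∷ S) (f j) ≈ 0#
    difference-roots j = begin
      - c * (f j * 1#) + evM S (f j) ≈⟨ +-cong (*-congˡ (*-identityʳ (f j))) (agree j) ⟩
      - c * f j + c * f j            ≈⟨ +-congʳ (-‿distribˡ-* c (f j)) ⟨
      - (c * f j) + c * f j          ≈⟨ -‿inverseˡ (c * f j) ⟩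
      0#                             ∎
    difference-coef≈0 : - c + coefM 1 S ≈ 0#
    difference-coef≈0 = monomials-vanishing⇒zero ((- c , 1) ∷ S) f f-inj difference-roots 1

  evalPoly-cong : ∀ {k} (Q : Poly k) {t t' : Fin k → Carrier} →
                  (∀ i → t i ≈ t' i) → evalPoly Q t ≈ evalPoly Q t'
  evalPoly-cong []            t≈t' = refl
  evalPoly-cong ((q , e) ∷ Q) t≈t' =
    +-cong (*-congˡ (prodFin-cong (λ i → pow-cong (lookup e i) (t≈t' i)))) (evalPoly-cong Q t≈t')
    where
    prodFin-cong : ∀ {k} {g h : Fin k → Carrier} → (∀ i → g i ≈ h i) → prodFin g ≈ prodFin h
    prodFin-cong {zero}  g≈h = refl
    prodFin-cong {suc k} g≈h = *-cong (g≈h Fin.zero) (prodFin-cong (g≈h ∘ Fin.suc))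

  onAxis : ∀ k' → Carrier → Fin (suc k') → Carrier
  onAxis zero     u Fin.zero    = u
  onAxis (suc k') u Fin.zero    = 0#
  onAxis (suc k') u (Fin.suc i) = onAxis k' u i

  onAxis-cases : ∀ k' u (i : Fin (suc k')) →
                 (toℕ i ≡ k' × onAxis k' u i ≡ u) ⊎ (toℕ i < k' × onAxis k' u i ≡ 0#)
  onAxis-cases zero     u Fin.zero    = inj₁ (≡.refl , ≡.refl)
  onAxis-cases (suc k') u Fin.zero    = inj₂ (s≤s z≤n , ≡.refl)
  onAxis-cases (suc k') u (Fin.suc i) with onAxis-cases k' u i
  ... | inj₁ (i≡k' , value) = inj₁ (≡.cong suc i≡k' , value)
  ... | inj₂ (i<k' , value) = inj₂ (s≤s i<k' , value)

  frontAtZero : ∀ {k'} → Vec ℕ (suc k') → Carrier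
  frontAtZero {zero}   (_ Vec.∷ Vec.[]) = 1#
  frontAtZero {suc k'} (x Vec.∷ e)      = pow 0# x * frontAtZero e

  monomial-onAxis : ∀ k' u (e : Vec ℕ (suc k')) →
    prodFin (λ i → pow (onAxis k' u i) (lookup e i)) ≈ frontAtZero e * pow u (lookup e (fromℕ k'))
  monomial-onAxis zero     u (x Vec.∷ Vec.[]) = trans (*-identityʳ _) (sym (*-identityˡ _))
  monomial-onAxis (suc k') u (x Vec.∷ e)      =
    trans (*-congˡ (monomial-onAxis k' u e)) (sym (*-assoc _ _ _))

  unitVec : ∀ k' → Vec ℕ (suc k')
  unitVec k' = replicate (suc k') 0 [ fromℕ k' ]≔ 1

  unitVec-last : ∀ k' → lookup (unitVec k') (fromℕ k') ≡ 1
  unitVec-last zero     = ≡.refl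
  unitVec-last (suc k') = unitVec-last k'

  frontAtZero-unitVec : ∀ k' → frontAtZero (unitVec k') ≈ 1#
  frontAtZero-unitVec zero     = refl
  frontAtZero-unitVec (suc k') = trans (*-identityˡ _) (frontAtZero-unitVec k')

  frontAtZero-nonUnit : ∀ k' (e : Vec ℕ (suc k')) → e ≢ unitVec k' →
                        lookup e (fromℕ k') ≢ 1 ⊎ frontAtZero e ≈ 0#
  frontAtZero-nonUnit zero     (x Vec.∷ Vec.[]) e≢t = inj₁ (λ x≡1 → e≢t (≡.cong (Vec._∷ Vec.[]) x≡1))
  frontAtZero-nonUnit (suc k') (zero Vec.∷ e)  e≢t
    with frontAtZero-nonUnit k' e (e≢t ∘ ≡.cong (0 Vec.∷_))
  ... | inj₁ eₖ≢1 = inj₁ eₖ≢1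
  ... | inj₂ e≈0  = inj₂ (trans (*-identityˡ _) e≈0)
  frontAtZero-nonUnit (suc k') (suc x Vec.∷ e) e≢t = inj₂ (trans (*-congʳ (zeroˡ _)) (zeroˡ _))

  restrict : ∀ {k'} → Poly (suc k') → Monomials
  restrict {k'} = map (λ (q , e) → ι q * frontAtZero e , lookup e (fromℕ k'))

  evalPoly-onAxis : ∀ k' (Q : Poly (suc k')) u → evalPoly Q (onAxis k' u) ≈ evM (restrict Q) u
  evalPoly-onAxis k' []            u = refl
  evalPoly-onAxis k' ((q , e) ∷ Q) u =
    +-cong (trans (*-congˡ (monomial-onAxis k' u e)) (sym (*-assoc _ _ _))) (evalPoly-onAxis k' Q u)

  coeffVar-restrict : ∀ k' (Q : Poly (suc k')) → ι (coeffVar Q (fromℕ k')) ≈ coefM 1 (restrict Q)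
  coeffVar-restrict k' []            = ι-0
  coeffVar-restrict k' ((q , e) ∷ Q) with ≡-dec ℕ._≟_ e (unitVec k')
  ... | yes ≡.refl = trans (ι-+ q _) (+-cong unit-term (coeffVar-restrict k' Q))
    where
    unit-term : ι q ≈ monoCoef 1 (lookup (unitVec k') (fromℕ k')) (ι q * frontAtZero (unitVec k'))
    unit-term rewrite unitVec-last k' = sym (trans (*-congˡ (frontAtZero-unitVec k')) (*-identityʳ _))
  ... | no e≢t = trans (coeffVar-restrict k' Q) (sym (trans (+-congʳ other-term) (+-identityˡ _)))
    where
    other-term : monoCoef 1 (lookup e (fromℕ k')) (ι q * frontAtZero e) ≈ 0#
    other-term with frontAtZero-nonUnit k' e e≢t
    ... | inj₁ eₖ≢1 = monoCoef-≢ (lookup e (fromℕ k')) eₖ≢1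
    ... | inj₂ e≈0  = monoCoef-zero 1 (lookup e (fromℕ k')) (trans (*-congˡ e≈0) (zeroʳ (ι q)))

  scaledZ : ℕ → ℕ → Carrier → Carrier → List Carrier
  scaledZ n k ζ l = map (l *_) (Z n k ζ)

  length-scaledZ : ∀ n k ζ l → k ≤ n → length (scaledZ n k ζ l) ≡ n
  length-scaledZ n k ζ l k≤n =
    ≡.trans (List.length-map (l *_) (Z n k ζ))
    (≡.trans (List.length-++ (map (pow ζ) (upTo k)))
    (≡.trans (≡.cong₂ ℕ._+_ (≡.trans (List.length-map (pow ζ) (upTo k)) (List.length-upTo k))
                            (List.length-replicate (n ℕ.∸ k)))
             (ℕ.m+[n∸m]≡n k≤n)))

  𝔭-scaledZ : ∀ n k' ζ l → IsPrimitiveRoot (suc k') ζ → ∀ (i : Fin (suc k')) →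
              𝔭 (suc (toℕ i)) (scaledZ n (suc k') ζ l) ≈ onAxis k' (pow l (suc k') * [ suc k' ]) i
  𝔭-scaledZ n k' ζ l root i
    with onAxis-cases k' (pow l (suc k') * [ suc k' ]) i
  ... | inj₁ (i≡k' , value) rewrite i≡k' | value =
    trans (𝔭-scale l (suc k') (Z n (suc k') ζ)) (*-congˡ (𝔭-Z-top n k' ζ (proj₁ root)))
  ... | inj₂ (i<k' , value) rewrite value =
    trans (𝔭-scale l (suc (toℕ i)) (Z n (suc k') ζ))
          (trans (*-congˡ (𝔭-Z-below n (suc k') ζ (suc (toℕ i)) root (s≤s z≤n) (s≤s i<k'))) (zeroʳ _))

  axisPoint : ℕ → ℕ → Carrier
  axisPoint k j = pow [ suc j ] k * [ k ]

  axisPoint-injective : ∀ k .{{_ : NonZero k}} → Injective _≡_ _≈_ (axisPoint k)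
  axisPoint-injective k {a} {b} same = ℕ.suc-injective (^-injectiveˡ k
    (ℕ.*-cancelʳ-≡ _ _ k ([]-injective (trans (sym (as-ℕ a)) (trans same (as-ℕ b))))))
    where
    as-ℕ : ∀ j → axisPoint k j ≈ [ suc j ℕ.^ k ℕ.* k ]
    as-ℕ j = sym (trans (×1-homo-* (suc j ℕ.^ k) k) (*-congʳ ([^] (suc j) k)))

lemma3p3 : ∀ {c ℓ} (F : CharZeroField c ℓ) →
    let open CharZeroField F
        open FieldOps F
    in (s k n : ℕ) .{{_ : NonZero k}} → k ≤ n → s ≤ n →
       (ζ : Carrier) → IsPrimitiveRoot k ζ →
       (Q : Poly k) →
       (∀ (A : Vec Carrier n) →
          𝔭 k (sSums s (toList A)) ≈ evalPoly Q (λ i → 𝔭 (suc (toℕ i)) (toList A))) →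
       ι (coeffVar Q (lastIdx k)) ≈ 𝔭 k (sSums s (Z n k ζ)) * ι ((+ 1) / k)
lemma3p3 F s k@(suc k') n k≤n _ ζ root Q identity = begin
  ι (coeffVar Q (fromℕ k'))  ≈⟨ coeffVar-restrict k' Q ⟩
  coefM 1 (restrict Q)       ≈⟨ linear-on-points⇒coef (restrict Q) (P * r) (axisPoint k)
                                                      (axisPoint-injective k) restriction-on-points ⟩
  P * r                      ∎
  where
  open CharZeroField F
  open FieldOps F
  open InField F
  open import Relation.Binary.Reasoning.Setoid setoid
  open import Algebra.Solver.Ring.NaturalCoefficients.Default commutativeSemiring
  P = 𝔭 k (sSums s (Z n k ζ))
  r = ι ((+ 1) / k)
  identity-on-lists : ∀ xs → length xs ≡ n →
                      𝔭 k (sSums s xs) ≈ evalPoly Q (λ i → 𝔭 (suc (toℕ i)) xs)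
  identity-on-lists = fromVecs (λ xs → 𝔭 k (sSums s xs) ≈ evalPoly Q (λ i → 𝔭 (suc (toℕ i)) xs)) identity
  -- Testing the identity on l·Z_{n,k} with l = j+1: Q(0,…,0,lᵏk) = lᵏ·P = (P/k)·lᵏk.
  restriction-on-points : ∀ j → evM (restrict Q) (axisPoint k j) ≈ P * r * axisPoint k j
  restriction-on-points j = begin
    evM (restrict Q) (axisPoint k j)               ≈⟨ evalPoly-onAxis k' Q (axisPoint k j) ⟨
    evalPoly Q (onAxis k' (axisPoint k j))         ≈⟨ evalPoly-cong Q (𝔭-scaledZ n k' ζ l root) ⟨
    evalPoly Q (λ i → 𝔭 (suc (toℕ i)) A)           ≈⟨ identity-on-lists A (length-scaledZ n k ζ l k≤n) ⟨
    𝔭 k (sSums s A)                                ≈⟨ 𝔭-sSums-scale l k s (Z n k ζ) ⟩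
    pow l k * P                                    ≈⟨ *-identityʳ _ ⟨
    pow l k * P * 1#                               ≈⟨ *-congˡ (ι[1/k]*k≈1 k') ⟨
    pow l k * P * (r * [ k ])                      ≈⟨ solve 4 (λ x P r K → x :* P :* (r :* K) := P :* r :* (x :* K))
                                                            refl (pow l k) P r [ k ] ⟩
    P * r * axisPoint k j                          ∎
    where
    l = [ suc j ]
    A = scaledZ n k ζ l
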